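{- For every $n\ge 2$, the direct capacity of the path $P_n$ on $n$ vertices satisfies $\mathrm{cap}^\times(P_n)=2$.
   Context: $d_G$ denotes shortest-path distance. For an integer $\ell\ge 0$, an $\ell$-track on a graph $G$ is a surjective function $f:\{0,\dots,\ell\}\to V(G)$ with $f(i)f(i+1)\in E(G)$ for all $0\le i<\ell$. For $f,g:\{0,\dots,\ell\}\to V(G)$, $m_G(f,g)=\min_i d_G(f(i),g(i))$; for a family $F=\{f_1,\dots,f_p\}$ with $p\ge2$, $m_G(F)=\min_{i\ne j}m_G(f_i,f_j)$. An $\ell$-tour is a family of $\ell$-tracks. The direct vertex span is $\sigma^\times_V(G)=\max\{m_G(f,g):\ell\ge0,\ f,g\ \ell\text{ -tracks on }G\}$ (it is known that $\sigma^\times_V(P_n)=1$ for $n\ge2$). The direct capacity $\mathrm{cap}^\times(G)$ is the maximum $c$ such that there is an $\ell$-tour $F=\{f_1,\dots,f_c\}$ on $G$ (for some $\ell$) with $m_G(F)=\sigma^\times_V(G)$. -}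

module Defs where

open import Data.Nat using (ℕ; zero; suc; _+_; _≤_)
open import Data.Fin using (Fin; toℕ; inject₁)
open import Data.Product using (Σ; ∃; ∃-syntax; _×_; _,_)
open import Data.Sum using (_⊎_)
open import Relation.Binary.PropositionalEquality using (_≡_; _≢_)

record Graph : Set₁ where
  field
    size : ℕ
    Adj  : Fin size → Fin size → Set
open Graph public

V : Graph → Set
V G = Fin (size G)

P : ℕ → Graph
P n = record { size = n ; Adj = λ i j → (suc (toℕ i) ≡ toℕ j) ⊎ (suc (toℕ j) ≡ toℕ i) }

data Walk (G : Graph) : V G → V G → ℕ → Set where
  here : ∀ {u} → Walk G u u zero
  step : ∀ {u w v k} → Adj G u w → Walk G w v k → Walk G u v (suc k)

IsDist : (G : Graph) → V G → V G → ℕ → Set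
IsDist G u v d = Walk G u v d × (∀ k → Walk G u v k → d ≤ k)

IsMax : (ℕ → Set) → ℕ → Set
IsMax Q k = Q k × (∀ j → Q j → j ≤ k)

record Track (G : Graph) (ℓ : ℕ) : Set where
  field
    fn   : Fin (suc ℓ) → V G
    adj  : ∀ (i : Fin ℓ) → Adj G (fn (inject₁ i)) (fn (Fin.suc i))
    surj : ∀ (v : V G) → ∃[ i ] fn i ≡ v
open Track public

MinDist : (G : Graph) {ℓ : ℕ} → (Fin (suc ℓ) → V G) → (Fin (suc ℓ) → V G) → ℕ → Set
MinDist G f g k =
  (∃[ i ] IsDist G (f i) (g i) k) × (∀ i d → IsDist G (f i) (g i) d → k ≤ d)

FamMinDist : (G : Graph) {ℓ p : ℕ} → (Fin p → Track G ℓ) → ℕ → Set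
FamMinDist G F k =
  (∃[ i ] ∃[ j ] (i ≢ j × MinDist G (fn (F i)) (fn (F j)) k))
  × (∀ i j → i ≢ j → ∀ d → MinDist G (fn (F i)) (fn (F j)) d → k ≤ d)

SpanValue : Graph → ℕ → Set
SpanValue G s = ∃[ ℓ ] Σ (Track G ℓ) λ f → Σ (Track G ℓ) λ g → MinDist G (fn f) (fn g) s

DirectVertexSpan : Graph → ℕ → Set
DirectVertexSpan G s = IsMax (SpanValue G) s

TourWith : Graph → ℕ → ℕ → Set
TourWith G s c = 2 ≤ c × (∃[ ℓ ] Σ (Fin c → Track G ℓ) λ F → FamMinDist G F s)

DirectCapacity : Graph → ℕ → Set
DirectCapacity G c = ∃[ s ] (DirectVertexSpan G s × IsMax (TourWith G s) c)

module Submission where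

-- Every track on P_n visits both ends, so for two tracks f, g the sign of f − g changes; as both
-- move by exactly one at each step, at some time |f − g| ≤ 1. Hence σ^×_V(P_n) ≤ 1, and the tracks
-- 0,1,…,n−1,n−2 and 1,0,1,…,n−1 never meet while starting adjacent, so σ^×_V(P_n) = 1 with a tour
-- of two tracks. Both coordinates flip parity at every step, so the parity of f(t) + g(t) is
-- constant; for two tracks that never meet it is odd, since they are adjacent at some time. Three
-- pairwise non-meeting tracks would give three parities with pairwise odd sums, which is impossible.

open import Data.Fin using (Fin; zero; suc; toℕ; inject₁; fromℕ)
open import Data.Fin.Properties using (toℕ-injective; toℕ-inject₁; toℕ-fromℕ; toℕ≤pred[n])
open import Data.Nat using (ℕ; zero; suc; _+_; _≤_; _<_; z≤n; s≤s; s≤s⁻¹; parity)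
open import Data.Nat.Properties
  using (module ≤-Reasoning; ≤-refl; ≤-trans; ≤-total; n≤1+n; m≤n⇒m≤1+n; m≤n⇒m<n∨m≡n;
         <⇒≤; <⇒≱; ≮⇒≥; n≮0; 1+n≢n)
open import Data.Parity using (Parity; 0ℙ; 1ℙ; _⁻¹) renaming (_+_ to _⊕_)
open import Data.Parity.Properties using (⁻¹-selfInverse; suc-homo-⁻¹; p+p⁻¹≡1ℙ; p+p≡0ℙ)
open import Data.Product using (∃-syntax; _,_; map; map₂)
open import Data.Sum as Sum using (_⊎_; inj₁; inj₂; swap)
open import Data.Vec.Functional using ([]; _∷_)
open import Data.Empty using (⊥; ⊥-elim)
open import Function using (_∘_; id)
open import Relation.Binary.PropositionalEquality
  using (_≡_; _≢_; refl; sym; trans; cong; cong₂; ≢-sym; module ≡-Reasoning)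

open import Defs

Step : ℕ → ℕ → Set
Step x y = suc x ≡ y ⊎ suc y ≡ x

Near : ℕ → ℕ → Set
Near x y = x ≡ y ⊎ Step x y

Near-sym : ∀ {x y} → Near x y → Near y x
Near-sym (inj₁ x≡y) = inj₁ (sym x≡y)
Near-sym (inj₂ s)   = inj₂ (swap s)

near-or-gap : ∀ {x y} → x ≤ y → Near x y ⊎ suc x < y
near-or-gap x≤y with m≤n⇒m<n∨m≡n x≤y
... | inj₂ x≡y = inj₁ (inj₁ x≡y)
... | inj₁ x<y with m≤n⇒m<n∨m≡n x<y
...   | inj₂ 1+x≡y = inj₁ (inj₂ (inj₁ 1+x≡y))
...   | inj₁ 1+x<y = inj₂ 1+x<y

step⇒≤suc : ∀ {x y} → Step x y → y ≤ suc x
step⇒≤suc (inj₁ refl)         = ≤-refl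
step⇒≤suc {y = y} (inj₂ refl) = m≤n⇒m≤1+n (n≤1+n y)

gap-persists : ∀ {x y x′ y′} → suc x < y → Step x x′ → Step y y′ → x′ ≤ y′
gap-persists gap sx sy = s≤s⁻¹ (≤-trans (s≤s (step⇒≤suc sx)) (≤-trans gap (step⇒≤suc (swap sy))))

StepSeq : ∀ {ℓ} → (Fin (suc ℓ) → ℕ) → Set
StepSeq {ℓ} a = ∀ (i : Fin ℓ) → Step (a (inject₁ i)) (a (suc i))

meet-from-below : ∀ {ℓ} (a b : Fin (suc ℓ) → ℕ) → StepSeq a → StepSeq b →
                  a zero ≤ b zero → ∀ j → b j ≤ a j → ∃[ k ] Near (a k) (b k)
meet-from-below a b sa sb a₀≤b₀ j bj≤aj with near-or-gap a₀≤b₀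
... | inj₁ near = zero , near
meet-from-below a b sa sb a₀≤b₀ zero b₀≤a₀ | inj₂ gap = ⊥-elim (<⇒≱ (<⇒≤ gap) b₀≤a₀)
meet-from-below {suc ℓ} a b sa sb a₀≤b₀ (suc j) bj≤aj | inj₂ gap =
  map suc id (meet-from-below (a ∘ suc) (b ∘ suc) (sa ∘ suc) (sb ∘ suc)
                              (gap-persists gap (sa zero) (sb zero)) j bj≤aj)

meet-of-crossing : ∀ {ℓ} (a b : Fin (suc ℓ) → ℕ) → StepSeq a → StepSeq b →
                   ∀ {i j} → a i ≤ b i → b j ≤ a j → ∃[ k ] Near (a k) (b k)
meet-of-crossing a b sa sb {i} {j} ai≤bi bj≤aj with ≤-total (a zero) (b zero)
... | inj₁ a₀≤b₀ = meet-from-below a b sa sb a₀≤b₀ j bj≤aj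
... | inj₂ b₀≤a₀ = map₂ Near-sym (meet-from-below b a sb sa b₀≤a₀ i ai≤bi)

stepwise-constant : ∀ {ℓ} {A : Set} (h : Fin (suc ℓ) → A) →
                    (∀ (i : Fin ℓ) → h (inject₁ i) ≡ h (suc i)) → ∀ t → h t ≡ h zero
stepwise-constant h steps zero = refl
stepwise-constant {suc ℓ} h steps (suc t) =
  trans (stepwise-constant (h ∘ suc) (steps ∘ suc) t) (sym (steps zero))

parity-step : ∀ {x y} → Step x y → parity y ≡ parity x ⁻¹
parity-step {x} (inj₁ refl)     = sym (⁻¹-selfInverse (suc-homo-⁻¹ x))
parity-step {y = y} (inj₂ refl) = sym (suc-homo-⁻¹ y)

step⇒odd-sum : ∀ {x y} → Step x y → parity x ⊕ parity y ≡ 1ℙ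
step⇒odd-sum {x} s = trans (cong (parity x ⊕_) (parity-step s)) (p+p⁻¹≡1ℙ (parity x))

p⁻¹+q⁻¹≡p+q : ∀ p q → p ⁻¹ ⊕ q ⁻¹ ≡ p ⊕ q
p⁻¹+q⁻¹≡p+q 0ℙ 0ℙ = refl
p⁻¹+q⁻¹≡p+q 0ℙ 1ℙ = refl
p⁻¹+q⁻¹≡p+q 1ℙ 0ℙ = refl
p⁻¹+q⁻¹≡p+q 1ℙ 1ℙ = refl

no-three-pairwise-odd : ∀ p q r → p ⊕ q ≡ 1ℙ → q ⊕ r ≡ 1ℙ → p ⊕ r ≡ 1ℙ → ⊥
no-three-pairwise-odd 0ℙ 0ℙ _  ()
no-three-pairwise-odd 1ℙ 1ℙ _  ()
no-three-pairwise-odd 0ℙ 1ℙ 0ℙ _ _ ()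
no-three-pairwise-odd 0ℙ 1ℙ 1ℙ _ ()
no-three-pairwise-odd 1ℙ 0ℙ 0ℙ _ ()
no-three-pairwise-odd 1ℙ 0ℙ 1ℙ _ _ ()

parity-sum-invariant : ∀ {ℓ} (a b : Fin (suc ℓ) → ℕ) → StepSeq a → StepSeq b →
                       ∀ t → parity (a t) ⊕ parity (b t) ≡ parity (a zero) ⊕ parity (b zero)
parity-sum-invariant a b sa sb = stepwise-constant (λ t → parity (a t) ⊕ parity (b t)) steps
  where
  open ≡-Reasoning
  steps : ∀ i → parity (a (inject₁ i)) ⊕ parity (b (inject₁ i)) ≡ parity (a (suc i)) ⊕ parity (b (suc i))
  steps i = begin
    p ⊕ q                                    ≡⟨ sym (p⁻¹+q⁻¹≡p+q p q) ⟩
    p ⁻¹ ⊕ q ⁻¹                              ≡⟨ sym (cong₂ _⊕_ (parity-step (sa i)) (parity-step (sb i))) ⟩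
    parity (a (suc i)) ⊕ parity (b (suc i))  ∎
    where
    p = parity (a (inject₁ i))
    q = parity (b (inject₁ i))

odd-start⇒never-equal : ∀ {ℓ} (a b : Fin (suc ℓ) → ℕ) → StepSeq a → StepSeq b →
                        Step (a zero) (b zero) → ∀ t → a t ≢ b t
odd-start⇒never-equal a b sa sb s t at≡bt = 0ℙ≢1ℙ (begin
  0ℙ                                 ≡⟨ sym (p+p≡0ℙ (parity (a t))) ⟩
  parity (a t) ⊕ parity (a t)        ≡⟨ cong (λ x → parity (a t) ⊕ parity x) at≡bt ⟩
  parity (a t) ⊕ parity (b t)        ≡⟨ parity-sum-invariant a b sa sb t ⟩
  parity (a zero) ⊕ parity (b zero)  ≡⟨ step⇒odd-sum s ⟩
  1ℙ                                 ∎)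
  where
  open ≡-Reasoning
  0ℙ≢1ℙ : 0ℙ ≢ 1ℙ
  0ℙ≢1ℙ ()

Disjoint : ∀ {A B : Set} → (A → B) → (A → B) → Set
Disjoint f g = ∀ t → f t ≢ g t

module _ {G : Graph} where

  walk-length-pos : ∀ {u v k} → u ≢ v → Walk G u v k → 1 ≤ k
  walk-length-pos u≢v here       = ⊥-elim (u≢v refl)
  walk-length-pos u≢v (step _ _) = s≤s z≤n

  ≡⇒dist-zero : ∀ {u v} → u ≡ v → IsDist G u v 0
  ≡⇒dist-zero refl = here , λ _ _ → z≤n

  ≢⇒dist-pos : ∀ {u v d} → u ≢ v → IsDist G u v d → 1 ≤ d
  ≢⇒dist-pos u≢v (w , _) = walk-length-pos u≢v w

  adj⇒dist-one : ∀ {u v} → Adj G u v → u ≢ v → IsDist G u v 1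
  adj⇒dist-one uv u≢v = step uv here , λ _ → walk-length-pos u≢v

  disjoint⇒minDist-pos : ∀ {ℓ d} {f g : Fin (suc ℓ) → V G} → Disjoint f g → MinDist G f g d → 1 ≤ d
  disjoint⇒minDist-pos f≠g ((t , dist) , _) = ≢⇒dist-pos (f≠g t) dist

  disjoint⇒minDist-one : ∀ {ℓ} {f g : Fin (suc ℓ) → V G} →
                         Disjoint f g → ∀ k → Adj G (f k) (g k) → MinDist G f g 1
  disjoint⇒minDist-one f≠g k adj =
    (k , adj⇒dist-one adj (f≠g k)) , λ t _ → ≢⇒dist-pos (f≠g t)

  famMinDist-pos⇒disjoint : ∀ {ℓ c s} (F : Fin c → Track G ℓ) → FamMinDist G F (suc s) →
                            ∀ i j → i ≢ j → Disjoint (fn (F i)) (fn (F j))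
  famMinDist-pos⇒disjoint F (_ , min≤) i j i≢j t e =
    n≮0 (min≤ i j i≢j 0 ((t , ≡⇒dist-zero e) , λ _ _ _ → z≤n))

  pair-famMinDist-one : ∀ {ℓ} (f g : Track G ℓ) → Disjoint (fn f) (fn g) →
                        ∀ k → Adj G (fn f k) (fn g k) → FamMinDist G (f ∷ g ∷ []) 1
  pair-famMinDist-one f g f≠g k adj =
    (zero , suc zero , (λ ()) , disjoint⇒minDist-one f≠g k adj) , bound
    where
    bound : ∀ i j → i ≢ j → ∀ d → MinDist G (fn ((f ∷ g ∷ []) i)) (fn ((f ∷ g ∷ []) j)) d → 1 ≤ d
    bound zero       zero       i≢j = ⊥-elim (i≢j refl)
    bound zero       (suc zero) _ _ = disjoint⇒minDist-pos f≠g
    bound (suc zero) zero       _ _ = disjoint⇒minDist-pos (λ t → ≢-sym (f≠g t))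
    bound (suc zero) (suc zero) i≢j = ⊥-elim (i≢j refl)

path-loopless : ∀ {n} {u v : V (P n)} → Adj (P n) u v → u ≢ v
path-loopless (inj₁ e) refl = 1+n≢n e
path-loopless (inj₂ e) refl = 1+n≢n e

-- Adjacency in P n is, by definition, Step on the underlying numbers.
track-steps : ∀ {n ℓ} (f : Track (P n) ℓ) → StepSeq (toℕ ∘ fn f)
track-steps = adj

path-tracks-meet : ∀ {m ℓ} (f g : Track (P (suc m)) ℓ) → ∃[ k ] Near (toℕ (fn f k)) (toℕ (fn g k))
path-tracks-meet {m} f g with surj f zero | surj f (fromℕ m)
... | i₀ , f[i₀]≡0 | i₁ , f[i₁]≡m =
  meet-of-crossing (toℕ ∘ fn f) (toℕ ∘ fn g) (track-steps f) (track-steps g) f≤g g≤f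
  where
  open ≤-Reasoning
  f≤g : toℕ (fn f i₀) ≤ toℕ (fn g i₀)
  f≤g = begin
    toℕ (fn f i₀) ≡⟨ cong toℕ f[i₀]≡0 ⟩
    0             ≤⟨ z≤n ⟩
    toℕ (fn g i₀) ∎
  g≤f : toℕ (fn g i₁) ≤ toℕ (fn f i₁)
  g≤f = begin
    toℕ (fn g i₁)   ≤⟨ toℕ≤pred[n] (fn g i₁) ⟩
    m               ≡⟨ sym (toℕ-fromℕ m) ⟩
    toℕ (fromℕ m)   ≡⟨ cong toℕ (sym f[i₁]≡m) ⟩
    toℕ (fn f i₁)   ∎

adjacent-start⇒disjoint : ∀ {n ℓ} (f g : Track (P n) ℓ) →
                          Adj (P n) (fn f zero) (fn g zero) → Disjoint (fn f) (fn g)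
adjacent-start⇒disjoint f g adj t e =
  odd-start⇒never-equal (toℕ ∘ fn f) (toℕ ∘ fn g) (track-steps f) (track-steps g) adj t (cong toℕ e)

disjoint⇒odd-start : ∀ {m ℓ} (f g : Track (P (suc m)) ℓ) → Disjoint (fn f) (fn g) →
                     parity (toℕ (fn f zero)) ⊕ parity (toℕ (fn g zero)) ≡ 1ℙ
disjoint⇒odd-start f g f≠g with path-tracks-meet f g
... | k , inj₁ e = ⊥-elim (f≠g k (toℕ-injective e))
... | k , inj₂ s =
  trans (sym (parity-sum-invariant (toℕ ∘ fn f) (toℕ ∘ fn g) (track-steps f) (track-steps g) k))
        (step⇒odd-sum s)

no-three-disjoint-path-tracks : ∀ {m ℓ} (f g h : Track (P (suc m)) ℓ) →
  Disjoint (fn f) (fn g) → Disjoint (fn g) (fn h) → Disjoint (fn f) (fn h) → ⊥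
no-three-disjoint-path-tracks {m} {ℓ} f g h f≠g g≠h f≠h =
  no-three-pairwise-odd (start f) (start g) (start h)
    (disjoint⇒odd-start f g f≠g) (disjoint⇒odd-start g h g≠h) (disjoint⇒odd-start f h f≠h)
  where
  start : Track (P (suc m)) ℓ → Parity
  start x = parity (toℕ (fn x zero))

path-span≤1 : ∀ {m s} → SpanValue (P (suc m)) s → s ≤ 1
path-span≤1 (ℓ , f , g , _ , min≤) with path-tracks-meet f g
... | k , inj₁ e = ≤-trans (min≤ k 0 (≡⇒dist-zero (toℕ-injective e))) z≤n
... | k , inj₂ s = min≤ k 1 (adj⇒dist-one s (path-loopless s))

path-tour≤2 : ∀ {m c} → TourWith (P (suc m)) 1 c → c ≤ 2
path-tour≤2 (_ , _ , F , fam) = ≮⇒≥ λ where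
  (s≤s (s≤s (s≤s _))) → no-three-disjoint-path-tracks (F zero) (F (suc zero)) (F (suc (suc zero)))
    (famMinDist-pos⇒disjoint F fam zero (suc zero) (λ ()))
    (famMinDist-pos⇒disjoint F fam (suc zero) (suc (suc zero)) (λ ()))
    (famMinDist-pos⇒disjoint F fam zero (suc (suc zero)) (λ ()))

-- With n = 2 + m, sweep is the track 0,1,…,n−1,n−2 and bounce is 1,0,1,…,n−1.
sweep : ∀ {m} → Fin (3 + m) → Fin (2 + m)
sweep           zero             = zero
sweep {zero}    (suc zero)       = suc zero
sweep {zero}    (suc (suc zero)) = zero
sweep {suc m}   (suc i)          = suc (sweep i)

sweep-steps : ∀ {m} → StepSeq (toℕ ∘ sweep {m})
sweep-steps {zero}  zero       = inj₁ refl
sweep-steps {zero}  (suc zero) = inj₂ refl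
sweep-steps {suc m} zero       = inj₁ refl
sweep-steps {suc m} (suc i)    = Sum.map (cong suc) (cong suc) (sweep-steps i)

sweep-inject₁ : ∀ {m} (v : Fin (2 + m)) → sweep (inject₁ v) ≡ v
sweep-inject₁ {zero}  zero       = refl
sweep-inject₁ {zero}  (suc zero) = refl
sweep-inject₁ {suc m} zero       = refl
sweep-inject₁ {suc m} (suc v)    = cong suc (sweep-inject₁ v)

bounce : ∀ {m} → Fin (3 + m) → Fin (2 + m)
bounce zero    = suc zero
bounce (suc i) = i

bounce-steps : ∀ {m} → StepSeq (toℕ ∘ bounce {m})
bounce-steps zero    = inj₂ refl
bounce-steps (suc i) = inj₁ (cong suc (toℕ-inject₁ i))

sweep-track : ∀ m → Track (P (2 + m)) (2 + m)
sweep-track m = record { fn = sweep ; adj = sweep-steps ; surj = λ v → inject₁ v , sweep-inject₁ v }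

bounce-track : ∀ m → Track (P (2 + m)) (2 + m)
bounce-track m = record { fn = bounce ; adj = bounce-steps ; surj = λ v → suc v , refl }

proposition3p9 : ∀ (n : ℕ) → 2 ≤ n → DirectCapacity (P n) 2
proposition3p9 (suc (suc m)) (s≤s (s≤s _)) =
  1 , ((2 + m , f , g , disjoint⇒minDist-one apart zero start-adj) , λ _ → path-span≤1)
    , ((≤-refl , 2 + m , f ∷ g ∷ [] , pair-famMinDist-one f g apart zero start-adj) , λ _ → path-tour≤2)
  where
  f g : Track (P (2 + m)) (2 + m)
  f = sweep-track m
  g = bounce-track m
  start-adj : Adj (P (2 + m)) (fn f zero) (fn g zero)
  start-adj = inj₁ refl
  apart : Disjoint (fn f) (fn g)
  apart = adjacent-start⇒disjoint f g start-adj
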